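{- There is an inner algorithm for three-dimensional \textsc{Tarski} that makes $O(\log n)$ queries, where $n$ is the width of the lattice.
   Context: For positive integers $n_1,\dots,n_k$, the lattice $L = L(n_1,\dots,n_k)$ is the set of all $x \in \mathbb{N}^k$ with $1 \le x_i \le n_i$, ordered by $x \preceq y$ iff $x_i \le y_i$ for all $i$; its width is $n=\max_i n_i$. Here $k=3$ and $f : L \to L$ is accessed by queries (evaluations of $f$). Define $\mathrm{Up}(f) = \{x \in L : x \preceq f(x)\}$ and $\mathrm{Down}(f) = \{x \in L : f(x) \preceq x\}$. For $x \preceq y$, the sub-instance $L_{x,y} = \{a \in L : x \preceq a \preceq y\}$. A slice is a tuple $s = (s_1,\dots,s_k)$ with each $s_i \in \mathbb{N} \cup \{*\}$, and $L_s = \{x \in L : x_i = s_i \text{ whenever } s_i \ne *\}$; a principal slice fixes exactly one coordinate (exactly one $s_i \neq *$). Two points $x,y$ witness a violation of order preservation of $f$ if $x \preceq y$ and $f(x) \not\preceq f(y)$. An inner algorithm is an algorithm that takes as input a sub-instance $L_{a,b}$ with $a \preceq b$, $a \in \mathrm{Up}(f)$ and $b \in \mathrm{Down}(f)$, and a principal slice $s$ of that sub-instance, and outputs either a point $x \in L_{a,b} \cap L_s$ such that $x \in \mathrm{Up}(f)$ or $x \in \mathrm{Down}(f)$, or two points $x, y \in L_{a,b}$ that witness a violation of order preservation of $f$. -}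

module Defs where

open import Data.Nat using (ℕ; zero; suc; _+_; _*_; _⊔_)
open import Data.Nat.Logarithm using (⌊log₂_⌋)
open import Data.Fin using (Fin; toℕ)
import Data.Fin as F
open import Data.Product using (_×_; Σ)
open import Data.Sum using (_⊎_)
open import Relation.Nullary using (¬_)
open import Relation.Binary.PropositionalEquality using (_≡_)

Dims : Set
Dims = Fin 3 → ℕ

-- A point of the lattice L(n₁,n₂,n₃).  Coordinate i is an element of
-- Fin (ns i); the Fin value j represents the paper's coordinate j+1,
-- so the range 1..n_i of the paper is 0..n_i-1 here.
Pt : Dims → Set
Pt ns = (i : Fin 3) → Fin (ns i)

_≼_ : {ns : Dims} → Pt ns → Pt ns → Set
x ≼ y = ∀ i → x i F.≤ y i

width : Dims → ℕ
width ns = ns F.zero ⊔ (ns (F.suc F.zero) ⊔ ns (F.suc (F.suc F.zero)))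

Up : {ns : Dims} → (Pt ns → Pt ns) → Pt ns → Set
Up f x = x ≼ f x

Down : {ns : Dims} → (Pt ns → Pt ns) → Pt ns → Set
Down f x = f x ≼ x

InSub : {ns : Dims} → Pt ns → Pt ns → Pt ns → Set
InSub a b x = a ≼ x × x ≼ b

InSlice : {ns : Dims} → (i : Fin 3) → Fin (ns i) → Pt ns → Set
InSlice i v x = x i ≡ v

Violation : {ns : Dims} → (Pt ns → Pt ns) → Pt ns → Pt ns → Set
Violation f x y = x ≼ y × ¬ (f x ≼ f y)

data Output (ns : Dims) : Set where
  point : Pt ns → Output ns
  pair  : Pt ns → Pt ns → Output ns

-- Query algorithms (decision trees): either stop with an output, or
-- query f at a point and continue depending on the answer.
data QTree (ns : Dims) : Set where
  ret   : Output ns → QTree ns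
  query : Pt ns → (Pt ns → QTree ns) → QTree ns

run : {ns : Dims} → QTree ns → (Pt ns → Pt ns) → Output ns
run (ret o) f = o
run (query x k) f = run (k (f x)) f

queries : {ns : Dims} → QTree ns → (Pt ns → Pt ns) → ℕ
queries (ret o) f = 0
queries (query x k) f = suc (queries (k (f x)) f)

CorrectInner : {ns : Dims} → (Pt ns → Pt ns) → (a b : Pt ns) →
               (i : Fin 3) → Fin (ns i) → Output ns → Set
CorrectInner f a b i v (point x) =
  InSub a b x × InSlice i v x × (Up f x ⊎ Down f x)
CorrectInner f a b i v (pair x y) =
  InSub a b x × InSub a b y × Violation f x y

InnerAlg : Set
InnerAlg = (ns : Dims) → (a b : Pt ns) → (i : Fin 3) → (v : Fin (ns i)) → QTree ns

-- The search stays in the slice x_i = v and maintains a box [lo, hi] inside it together with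
-- the list A of points queried so far, under the invariant that every fixed point of f clamped
-- to the box is Up or Down, or forms a violation with a point of A.  Initially the box is the
-- slice of [a, b] and A = [a, b]: a clamped fixed point at which f leaves the box in a free
-- coordinate violates monotonicity against a or b.  A one-point box is its own clamped fixed
-- point, so querying it and scanning A ends the search.  Each round queries at most four points
-- of the box and either stops, or halves one side of the box (drops a column, if that side has
-- width 1): a clamped fixed point of the new box that was not one of the old box lies on the cut
-- line with f pointing out of the new box, and unless it is Up or Down, one of the fresh queries
-- forms a violation with it.  So there are O(log n) rounds, each adding O(1) queries and O(1)
-- points to A.
module Submission where

open import Defs
open import Data.Nat using (ℕ; zero; suc; _+_; _*_; _≤_; _<_; _∸_; _^_; z≤n; s≤s; _≤?_; _<?_; ⌊_/2⌋; ⌈_/2⌉)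
open import Data.Nat.Properties
open import Data.Nat.Logarithm
  using (⌊log₂_⌋; ⌈log₂_⌉; ⌊log₂⌋-mono-≤; ⌊log₂[2^n]⌋≡n; ⌈log₂⌉-mono-≤; ⌈log₂⌈n/2⌉⌉≡⌈log₂n⌉∸1; ⌈log₂2^n⌉≡n)
open import Data.Nat.Tactic.RingSolver using (solve-∀)
open import Data.Fin using (Fin; toℕ; fromℕ<)
import Data.Fin as F
import Data.Fin.Properties as FP
open import Data.Product using (_×_; Σ; ∃-syntax; _,_; uncurry)
import Data.Product as Product
open import Data.Sum using (_⊎_; inj₁; inj₂; [_,_]′)
import Data.Sum as Sum
open import Data.List using (List; []; _∷_; _++_; length)
open import Data.List.Relation.Unary.Any using (Any; here; there)
open import Data.List.Relation.Unary.Any.Properties using (++⁺ʳ)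
open import Data.List.Relation.Unary.All using (All; []; _∷_)
import Data.List.Relation.Unary.All.Properties as All
open import Data.List.Membership.Propositional using (_∈_; lose)
open import Data.Empty using (⊥-elim)
open import Function using (_$_; _∘_)
open import Relation.Nullary using (¬_; Dec; yes; no)
open import Relation.Nullary.Decidable using (¬?; _×-dec_; _⊎-dec_)
open import Relation.Binary.Definitions using (tri<; tri≈; tri>)
open import Relation.Binary.PropositionalEquality
  using (_≡_; refl; sym; trans; cong; subst; subst₂; _≢_; module ≡-Reasoning)

pattern 0F = F.zero
pattern 1F = F.suc F.zero
pattern 2F = F.suc (F.suc F.zero)

record Complement (i d e : Fin 3) : Set where
  field
    d≢i : d ≢ i
    e≢i : e ≢ i
    d≢e : d ≢ e
    cover : ∀ c → c ≡ i ⊎ c ≡ d ⊎ c ≡ e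

complement-swap : ∀ {i d e} → Complement i d e → Complement i e d
complement-swap T = record
  { d≢i = e≢i ; e≢i = d≢i ; d≢e = d≢e ∘ sym ; cover = Sum.map₂ Sum.swap ∘ cover }
  where open Complement T

other₁ other₂ : Fin 3 → Fin 3
other₁ 0F = 1F
other₁ (F.suc _) = 0F
other₂ 0F = 2F
other₂ 1F = 2F
other₂ 2F = 1F

complement : ∀ i → Complement i (other₁ i) (other₂ i)
complement 0F = record { d≢i = λ () ; e≢i = λ () ; d≢e = λ ()
  ; cover = λ { 0F → inj₁ refl ; 1F → inj₂ (inj₁ refl) ; 2F → inj₂ (inj₂ refl) } }
complement 1F = record { d≢i = λ () ; e≢i = λ () ; d≢e = λ ()
  ; cover = λ { 0F → inj₂ (inj₁ refl) ; 1F → inj₁ refl ; 2F → inj₂ (inj₂ refl) } }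
complement 2F = record { d≢i = λ () ; e≢i = λ () ; d≢e = λ ()
  ; cover = λ { 0F → inj₂ (inj₁ refl) ; 1F → inj₂ (inj₂ refl) ; 2F → inj₁ refl } }

≤-by-≡ : ∀ {m m′ n n′} → m ≡ m′ → n ≡ n′ → m′ ≤ n′ → m ≤ n
≤-by-≡ refl refl m′≤n′ = m′≤n′

2≰h∸l⇒h≤1+l : ∀ {l h} → ¬ 2 ≤ h ∸ l → h ≤ suc l
2≰h∸l⇒h≤1+l {l} {h} 2≰ = subst (h ≤_) (+-comm l 1) (≤-trans (m≤n+m∸n h l) (+-monoʳ-≤ l (≤-pred (≰⇒> 2≰))))

1≤h∸l≱2⇒h≡1+l : ∀ {l h} → 1 ≤ h ∸ l → ¬ 2 ≤ h ∸ l → h ≡ suc l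
1≤h∸l≱2⇒h≡1+l 1≤ 2≰ = ≤-antisym (2≰h∸l⇒h≤1+l 2≰) (m∸n≢0⇒n<m (λ h∸l≡0 → <⇒≱ 1≤ (≤-reflexive h∸l≡0)))

fromℕ-or : ∀ {m} → ℕ → Fin m → Fin m
fromℕ-or {m} n x with n <? m
... | yes n<m = fromℕ< n<m
... | no _ = x

toℕ-fromℕ-or : ∀ {m n} (x : Fin m) → n < m → toℕ (fromℕ-or n x) ≡ n
toℕ-fromℕ-or {m} {n} x n<m with n <? m
... | yes n<m′ = FP.toℕ-fromℕ< n<m′
... | no n≮m = ⊥-elim (n≮m n<m)

mid : ℕ → ℕ → ℕ
mid l h = l + ⌊ (h ∸ l) /2⌋

l≤mid : ∀ l h → l ≤ mid l h
l≤mid l h = m≤m+n l _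

mid≤h : ∀ {l h} → l ≤ h → mid l h ≤ h
mid≤h {l} {h} l≤h = ≤-trans (+-monoʳ-≤ l (⌊n/2⌋≤n (h ∸ l))) (≤-reflexive (m+[n∸m]≡n l≤h))

l<mid : ∀ {l h} → 2 ≤ h ∸ l → l < mid l h
l<mid {l} 2≤ = m<m+n l (⌊n/2⌋-mono 2≤)

mid<h : ∀ {l h} → l ≤ h → 2 ≤ h ∸ l → mid l h < h
mid<h {l} {h} l≤h 2≤ = <-≤-trans (+-monoʳ-< l (half< 2≤)) (≤-reflexive (m+[n∸m]≡n l≤h))
  where
  half< : ∀ {s} → 2 ≤ s → ⌊ s /2⌋ < s
  half< {suc s} _ = ⌊n/2⌋<n s

mid∸l≤⌈/2⌉ : ∀ l h → mid l h ∸ l ≤ ⌈ (h ∸ l) /2⌉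
mid∸l≤⌈/2⌉ l h = ≤-by-≡ (m+n∸m≡n l _) refl (⌊n/2⌋≤⌈n/2⌉ (h ∸ l))

h∸mid≡⌈/2⌉ : ∀ l h → h ∸ mid l h ≡ ⌈ (h ∸ l) /2⌉
h∸mid≡⌈/2⌉ l h = begin
  h ∸ (l + ⌊ s /2⌋)            ≡⟨ sym (∸-+-assoc h l ⌊ s /2⌋) ⟩
  s ∸ ⌊ s /2⌋                  ≡⟨ cong (_∸ ⌊ s /2⌋) (sym (⌊n/2⌋+⌈n/2⌉≡n s)) ⟩
  ⌊ s /2⌋ + ⌈ s /2⌉ ∸ ⌊ s /2⌋  ≡⟨ m+n∸m≡n ⌊ s /2⌋ ⌈ s /2⌉ ⟩
  ⌈ s /2⌉                      ∎
  where
  open ≡-Reasoning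
  s = h ∸ l

rank : ℕ → ℕ
rank zero = zero
rank (suc s) = suc ⌈log₂ suc s ⌉

rank-< : ∀ {s s′} → 2 ≤ s → s′ ≤ ⌈ s /2⌉ → rank s′ < rank s
rank-< {suc _} {zero} _ _ = s≤s z≤n
rank-< {s@(suc _)} {s′@(suc _)} 2≤s s′≤ = s≤s (begin-strict
  ⌈log₂ s′ ⌉        ≤⟨ ⌈log₂⌉-mono-≤ s′≤ ⟩
  ⌈log₂ ⌈ s /2⌉ ⌉   ≡⟨ ⌈log₂⌈n/2⌉⌉≡⌈log₂n⌉∸1 s ⟩
  ⌈log₂ s ⌉ ∸ 1     <⟨ ∸-monoʳ-< (s≤s z≤n) (⌈log₂⌉-mono-≤ 2≤s) ⟩
  ⌈log₂ s ⌉         ∎)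
  where open ≤-Reasoning

rank-≤ : ∀ {s K} → s ≤ 2 ^ K → rank s ≤ suc K
rank-≤ {zero} _ = z≤n
rank-≤ {suc s} {K} s≤ = s≤s (subst (⌈log₂ suc s ⌉ ≤_) (⌈log₂2^n⌉≡n K) (⌈log₂⌉-mono-≤ s≤))

≡⇒rank≤ : ∀ {s s′} → s ≡ s′ → rank s ≤ rank s′
≡⇒rank≤ = ≤-reflexive ∘ cong rank

rank≤0 : ∀ {s} → rank s ≤ 0 → s ≡ 0
rank≤0 {zero} _ = refl

rank-1 : ∀ {s s′} → s′ ≡ 0 → s ≡ 1 → rank s′ < rank s
rank-1 refl refl = s≤s z≤n

-- A round makes m ≤ 4 queries and adds m points to A, each costing one more query at the end.
step-cost : ∀ {q F n} m → m ≤ 4 → q ≤ 8 * F + 1 + (m + n) → m + q ≤ 8 * suc F + 1 + n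
step-cost {q} {F} {n} m m≤4 q≤ = begin
  m + q                      ≤⟨ +-monoʳ-≤ m q≤ ⟩
  m + (8 * F + 1 + (m + n))  ≡⟨ regroup m F n ⟩
  (m + m) + (8 * F + 1 + n)  ≤⟨ +-monoˡ-≤ (8 * F + 1 + n) (+-mono-≤ m≤4 m≤4) ⟩
  8 + (8 * F + 1 + n)        ≡⟨ unfold F n ⟩
  8 * suc F + 1 + n          ∎
  where
  open ≤-Reasoning
  regroup : ∀ m F n → m + (8 * F + 1 + (m + n)) ≡ (m + m) + (8 * F + 1 + n)
  regroup = solve-∀
  unfold : ∀ F n → 8 + (8 * F + 1 + n) ≡ 8 * suc F + 1 + n
  unfold = solve-∀

finish-cost : ∀ F n → suc n ≤ 8 * F + 1 + n
finish-cost F n = ≤-trans (m≤n+m (suc n) (8 * F)) (≤-reflexive (sym (+-assoc (8 * F) 1 n)))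

query-bound : ∀ L → 8 * (3 * (2 + L)) + 1 + 2 ≤ 51 * suc L
query-bound L = ≤-trans (m≤m+n _ (27 * L)) (≤-reflexive (eq L))
  where
  eq : ∀ L → 8 * (3 * (2 + L)) + 1 + 2 + 27 * L ≡ 51 * suc L
  eq = solve-∀

n<2^[1+⌊log₂n⌋] : ∀ n → n < 2 ^ suc ⌊log₂ n ⌋
n<2^[1+⌊log₂n⌋] n with 2 ^ suc ⌊log₂ n ⌋ ≤? n
... | yes 2^≤n =
  ⊥-elim (1+n≰n (subst (_≤ ⌊log₂ n ⌋) (⌊log₂[2^n]⌋≡n (suc ⌊log₂ n ⌋)) (⌊log₂⌋-mono-≤ 2^≤n)))
... | no 2^≰n = ≰⇒> 2^≰n

ns≤width : ∀ ns c → ns c ≤ width ns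
ns≤width ns 0F = m≤m⊔n _ _
ns≤width ns 1F = ≤-trans (m≤m⊔n _ _) (m≤n⊔m (ns 0F) _)
ns≤width ns 2F = ≤-trans (m≤n⊔m _ _) (m≤n⊔m (ns 0F) _)

module Points (ns : Dims) where

  infixl 9 _!_
  infixl 30 _[_]≔_
  _!_ : Pt ns → Fin 3 → ℕ
  x ! c = toℕ (x c)

  _[_]≔_ : Pt ns → (d : Fin 3) → Fin (ns d) → Pt ns
  (x [ d ]≔ a) c with d F.≟ c
  ... | yes refl = a
  ... | no _ = x c

  []≔-same : ∀ x d a → (x [ d ]≔ a) ! d ≡ toℕ a
  []≔-same x d a with d F.≟ d
  ... | yes refl = refl
  ... | no d≢d = ⊥-elim (d≢d refl)

  []≔-other : ∀ x {d} a {c} → d ≢ c → (x [ d ]≔ a) ! c ≡ x ! c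
  []≔-other x {d} a {c} d≢c with d F.≟ c
  ... | yes refl = ⊥-elim (d≢c refl)
  ... | no _ = refl

  ≼-refl : {x : Pt ns} → x ≼ x
  ≼-refl c = ≤-refl

  ≼-trans : {x y z : Pt ns} → x ≼ y → y ≼ z → x ≼ z
  ≼-trans x≼y y≼z c = ≤-trans (x≼y c) (y≼z c)

  infix 4 _≼?_
  _≼?_ : (x y : Pt ns) → Dec (x ≼ y)
  x ≼? y = FP.all? (λ c → toℕ (x c) ≤? toℕ (y c))

  ≼-by-coords : ∀ {i d e} → Complement i d e → {x y : Pt ns} →
    x ! i ≤ y ! i → x ! d ≤ y ! d → x ! e ≤ y ! e → x ≼ y
  ≼-by-coords T ≤i ≤d ≤e c with Complement.cover T c
  ... | inj₁ refl = ≤i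
  ... | inj₂ (inj₁ refl) = ≤d
  ... | inj₂ (inj₂ refl) = ≤e

  []≔-≼ : ∀ {x y d a} → x ≼ y → toℕ a ≤ y ! d → x [ d ]≔ a ≼ y
  []≔-≼ {d = d} x≼y a≤ c with d F.≟ c
  ... | yes refl = a≤
  ... | no _ = x≼y c

  ≼-[]≔ : ∀ {x y d a} → x ≼ y → x ! d ≤ toℕ a → x ≼ y [ d ]≔ a
  ≼-[]≔ {d = d} x≼y ≤a c with d F.≟ c
  ... | yes refl = ≤a
  ... | no _ = x≼y c

  span : Pt ns → Pt ns → Fin 3 → ℕ
  span lo hi c = hi ! c ∸ lo ! c

  span-[]≔lo : ∀ lo hi {d} a {c} → d ≢ c → span (lo [ d ]≔ a) hi c ≡ span lo hi c
  span-[]≔lo lo hi a d≢c = cong (hi ! _ ∸_) ([]≔-other lo a d≢c)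

  span-[]≔hi : ∀ lo hi {d} a {c} → d ≢ c → span lo (hi [ d ]≔ a) c ≡ span lo hi c
  span-[]≔hi lo hi a d≢c = cong (_∸ lo ! _) ([]≔-other hi a d≢c)

  potential : Pt ns → Pt ns → ℕ
  potential lo hi = rank (span lo hi 0F) + rank (span lo hi 1F) + rank (span lo hi 2F)

  potential-< : ∀ {lo hi lo′ hi′} d → (∀ c → d ≢ c → span lo′ hi′ c ≡ span lo hi c) →
    rank (span lo′ hi′ d) < rank (span lo hi d) → potential lo′ hi′ < potential lo hi
  potential-< 0F same lt = +-mono-<-≤ (+-mono-<-≤ lt (≡⇒rank≤ (same 1F λ ()))) (≡⇒rank≤ (same 2F λ ()))
  potential-< 1F same lt = +-mono-<-≤ (+-mono-≤-< (≡⇒rank≤ (same 0F λ ())) lt) (≡⇒rank≤ (same 2F λ ()))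
  potential-< 2F same lt = +-mono-≤-< (+-mono-≤ (≡⇒rank≤ (same 0F λ ())) (≡⇒rank≤ (same 1F λ ()))) lt

  potential-≤ : ∀ {lo hi X} → (∀ c → rank (span lo hi c) ≤ X) → potential lo hi ≤ 3 * X
  potential-≤ {X = X} ≤X = ≤-trans (+-mono-≤ (+-mono-≤ (≤X 0F) (≤X 1F)) (≤X 2F)) (≤-reflexive (eq X))
    where
    eq : ∀ X → X + X + X ≡ 3 * X
    eq = solve-∀

  rank≤potential : ∀ lo hi c → rank (span lo hi c) ≤ potential lo hi
  rank≤potential lo hi 0F = ≤-trans (m≤m+n _ _) (m≤m+n _ _)
  rank≤potential lo hi 1F = ≤-trans (m≤n+m _ (rank (span lo hi 0F))) (m≤m+n _ _)
  rank≤potential lo hi 2F = m≤n+m _ _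

  potential≤0 : ∀ {lo hi} → potential lo hi ≤ 0 → ∀ c → span lo hi c ≡ 0
  potential≤0 {lo} {hi} Φ≤0 c = rank≤0 (≤-trans (rank≤potential lo hi c) Φ≤0)

data Step (ns : Dims) : Set where
  done : Output ns → Step ns
  next : Pt ns → Pt ns → Step ns

choose : ∀ {P A : Set} → Dec P → A → A → A
choose (yes _) x y = x
choose (no _) x y = y

choose-elim : ∀ {P A : Set} (Q : A → Set) {x y : A} (D : Dec P) →
  (P → Q x) → (¬ P → Q y) → Q (choose D x y)
choose-elim Q (yes p) qx qy = qx p
choose-elim Q (no ¬p) qx qy = qy ¬p

module Algorithm (ns : Dims) (i : Fin 3) (v : Fin (ns i)) where
  open Points ns

  violation? : (x fx y fy : Pt ns) → Dec (x ≼ y × ¬ (fx ≼ fy))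
  violation? x fx y fy = x ≼? y ×-dec ¬? (fx ≼? fy)

  findViolation : (z fz : Pt ns) → List (Pt ns) → QTree ns
  findViolation z fz [] = ret (point z)
  findViolation z fz (p ∷ A) = query p λ fp →
    choose (violation? p fp z fz) (ret (pair p z)) $
    choose (violation? z fz p fp) (ret (pair z p)) $
    findViolation z fz A

  finish : Pt ns → List (Pt ns) → QTree ns
  finish z A = query z λ fz →
    choose (z ≼? fz ⊎-dec fz ≼? z) (ret (point z)) (findViolation z fz A)

  -- A round on a box that is at least 2 wide in coordinate d: it cuts in d at the middle,
  -- or in e at the middle when the cut line in d is inconclusive.
  module Halving (d e : Fin 3) (lo hi : Pt ns) where

    -- The fallback lo d is only taken when lo ⋠ hi.
    cutD : Fin (ns d)
    cutD = fromℕ-or (mid (lo ! d) (hi ! d)) (lo d)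

    cutE : Fin (ns e)
    cutE = fromℕ-or (mid (lo ! e) (hi ! e)) (lo e)

    loCut hiCut centre loCutE hiCutE : Pt ns
    loCut = lo [ d ]≔ cutD
    hiCut = hi [ d ]≔ cutD
    centre = loCut [ e ]≔ cutE
    loCutE = lo [ e ]≔ cutE
    hiCutE = hi [ e ]≔ cutE

    thinDecision : (fLo fHi : Pt ns) → Step ns
    thinDecision fLo fHi =
      choose (fLo ! e ≤? lo ! e) (done (point loCut)) $
      choose (hi ! e ≤? fHi ! e) (done (point hiCut)) $
      done (pair loCut hiCut)

    centreDown centreUp : (fC : Pt ns) → Step ns
    centreDown fC = choose (fC ! e ≤? toℕ cutE) (done (point centre)) (next loCutE hi)
    centreUp fC = choose (toℕ cutE ≤? fC ! e) (done (point centre)) (next lo hiCutE)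

    centreDecision : (fC : Pt ns) → Step ns
    centreDecision fC =
      choose (fC ! d ≤? toℕ cutD ×-dec toℕ v ≤? fC ! i) (next lo hiCut) $
      choose (toℕ cutD ≤? fC ! d ×-dec fC ! i ≤? toℕ v) (next loCut hi) $
      choose (fC ! d ≤? toℕ cutD) (centreDown fC) (centreUp fC)

    decision : (fLo fHi fC : Pt ns) → Step ns
    decision fLo fHi fC =
      choose (toℕ cutD ≤? fLo ! d) (next loCut hi) $
      choose (fHi ! d ≤? toℕ cutD) (next lo hiCut) $
      choose (toℕ v ≤? fLo ! i) (next lo hiCut) $
      choose (fHi ! i ≤? toℕ v) (next loCut hi) $
      choose (2 ≤? span lo hi e) (centreDecision fC) (thinDecision fLo fHi)

  -- A round on a box of width 1 in coordinate d and at most 1 in e: it queries the four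
  -- corners and drops one column in d.
  module Corners (d e : Fin 3) (lo hi : Pt ns) where

    loHi hiLo : Pt ns
    loHi = lo [ d ]≔ hi d
    hiLo = hi [ d ]≔ lo d

    decision : (fLo fHiLo fLoHi fHi : Pt ns) → Step ns
    decision fLo fHiLo fLoHi fHi =
      choose (hi ! d ≤? fLo ! d) (next loHi hi) $
      choose (hi ! d ≤? fLoHi ! d) (next loHi hi) $
      choose (fHiLo ! d ≤? lo ! d) (next lo hiLo) $
      choose (fHi ! d ≤? lo ! d) (next lo hiLo) $
      choose (toℕ v ≤? fLo ! i) (next lo hiLo) $
      choose (fHi ! i ≤? toℕ v) (next loHi hi) $
      choose (fLo ! e ≤? lo ! e) (done (point lo)) $
      choose (hi ! e ≤? fHi ! e) (done (point hi)) $
      done (pair lo hi)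

  halvingStep : (d e : Fin 3) (lo hi : Pt ns) → List (Pt ns) →
    (Step ns → List (Pt ns) → QTree ns) → QTree ns
  halvingStep d e lo hi A κ =
    query loCut λ fLo → query hiCut λ fHi → query centre λ fC →
    κ (decision fLo fHi fC) (loCut ∷ hiCut ∷ centre ∷ A)
    where open Halving d e lo hi

  cornerStep : (d e : Fin 3) (lo hi : Pt ns) → List (Pt ns) →
    (Step ns → List (Pt ns) → QTree ns) → QTree ns
  cornerStep d e lo hi A κ =
    query lo λ fLo → query hiLo λ fHiLo → query loHi λ fLoHi → query hi λ fHi →
    κ (decision fLo fHiLo fLoHi fHi) (lo ∷ hiLo ∷ loHi ∷ hi ∷ A)
    where open Corners d e lo hi

  j k : Fin 3
  j = other₁ i
  k = other₂ i

  mutual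
    search : ℕ → Pt ns → Pt ns → List (Pt ns) → QTree ns
    search zero lo hi A = finish lo A
    search (suc F) lo hi A =
      choose (2 ≤? span lo hi j) (halvingStep j k lo hi A (proceed F)) $
      choose (2 ≤? span lo hi k) (halvingStep k j lo hi A (proceed F)) $
      choose (1 ≤? span lo hi j) (cornerStep j k lo hi A (proceed F)) $
      choose (1 ≤? span lo hi k) (cornerStep k j lo hi A (proceed F)) $
      finish lo A

    proceed : ℕ → Step ns → List (Pt ns) → QTree ns
    proceed F (done o) A = ret o
    proceed F (next lo hi) A = search F lo hi A

fuel : Dims → ℕ
fuel ns = 3 * (2 + ⌊log₂ width ns ⌋)

inner : InnerAlg
inner ns a b i v = search (fuel ns) (a [ i ]≔ v) (b [ i ]≔ v) (a ∷ b ∷ [])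
  where
  open Points ns
  open Algorithm ns i v

-- Clamped l h x y: clamping y into [l, h] gives x.
data Clamped (l h x y : ℕ) : Set where
  fixed : y ≡ x → Clamped l h x y
  below : y < x → x ≡ l → Clamped l h x y
  above : x < y → x ≡ h → Clamped l h x y

clamped-point : ∀ {l h x y} → l ≡ x → h ≡ x → Clamped l h x y
clamped-point {x = x} {y} l≡x h≡x with <-cmp y x
... | tri< y<x _ _ = below y<x (sym l≡x)
... | tri≈ _ y≡x _ = fixed y≡x
... | tri> _ _ x<y = above x<y (sym h≡x)

clamped⇒≤⊎≡l : ∀ {l h x y} → Clamped l h x y → x ≤ y ⊎ x ≡ l
clamped⇒≤⊎≡l (fixed y≡x) = inj₁ (≤-reflexive (sym y≡x))
clamped⇒≤⊎≡l (below _ x≡l) = inj₂ x≡l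
clamped⇒≤⊎≡l (above x<y _) = inj₁ (<⇒≤ x<y)

clamped⇒≥⊎≡h : ∀ {l h x y} → Clamped l h x y → y ≤ x ⊎ x ≡ h
clamped⇒≥⊎≡h (fixed y≡x) = inj₁ (≤-reflexive y≡x)
clamped⇒≥⊎≡h (below y<x _) = inj₁ (<⇒≤ y<x)
clamped⇒≥⊎≡h (above _ x≡h) = inj₂ x≡h

module Certificates (ns : Dims) (f : Pt ns → Pt ns) (i : Fin 3) (v : Fin (ns i)) where
  open Points ns

  ClampFixed : Pt ns → Pt ns → Pt ns → Set
  ClampFixed lo hi z = ∀ c → Clamped (lo ! c) (hi ! c) (z ! c) (f z ! c)

  Solution : Pt ns → Set
  Solution z = Up f z ⊎ Down f z

  ViolatesWith : Pt ns → Pt ns → Set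
  ViolatesWith z p = Violation f z p ⊎ Violation f p z

  Certified : Pt ns → Pt ns → List (Pt ns) → Set
  Certified lo hi A = ∀ z → lo ≼ z → z ≼ hi → ClampFixed lo hi z → Solution z ⊎ Any (ViolatesWith z) A

  certified-++ : ∀ {lo hi A} B → Certified lo hi A → Certified lo hi (B ++ A)
  certified-++ B cert z lo≼z z≼hi z-fixed = Sum.map₂ (++⁺ʳ B) (cert z lo≼z z≼hi z-fixed)

  violation-at : ∀ {p q} → p ≼ q → ∀ c → f q ! c < f p ! c → Violation f p q
  violation-at p≼q c lt = p≼q , λ fp≼fq → <⇒≱ lt (fp≼fq c)

  slice-squeeze : ∀ {lo hi z} → lo ! i ≡ toℕ v → hi ! i ≡ toℕ v → lo ≼ z → z ≼ hi → z ! i ≡ toℕ v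
  slice-squeeze lo-i hi-i lo≼z z≼hi =
    ≤-antisym (≤-by-≡ refl (sym hi-i) (z≼hi i)) (≤-by-≡ (sym lo-i) refl (lo≼z i))

  clampFixed-outside : ∀ {lo hi lo′ hi′ z} d →
    (∀ c → d ≢ c → lo′ ! c ≡ lo ! c) → (∀ c → d ≢ c → hi′ ! c ≡ hi ! c) →
    ClampFixed lo′ hi′ z → Clamped (lo ! d) (hi ! d) (z ! d) (f z ! d) → ClampFixed lo hi z
  clampFixed-outside d same-lo same-hi z-fixed z-fixed-d c with d F.≟ c
  ... | yes refl = z-fixed-d
  ... | no d≢c = subst₂ (λ l h → Clamped l h _ _) (same-lo c d≢c) (same-hi c d≢c) (z-fixed c)

  clampFixed-[]≔hi : ∀ {lo hi z} d (a : Fin (ns d)) → ClampFixed lo (hi [ d ]≔ a) z →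
    ClampFixed lo hi z ⊎ (z ! d ≡ toℕ a × toℕ a < f z ! d)
  clampFixed-[]≔hi {lo} {hi} {z} d a z-fixed with z-fixed d
  ... | fixed eq = inj₁ (clampFixed-outside d (λ _ _ → refl) (λ _ → []≔-other hi a) z-fixed (fixed eq))
  ... | below lt eq = inj₁ (clampFixed-outside d (λ _ _ → refl) (λ _ → []≔-other hi a) z-fixed (below lt eq))
  ... | above lt eq = inj₂ (zd , subst (_< f z ! d) zd lt)
    where zd = trans eq ([]≔-same hi d a)

  clampFixed-[]≔lo : ∀ {lo hi z} d (a : Fin (ns d)) → ClampFixed (lo [ d ]≔ a) hi z →
    ClampFixed lo hi z ⊎ (z ! d ≡ toℕ a × f z ! d < toℕ a)
  clampFixed-[]≔lo {lo} {hi} {z} d a z-fixed with z-fixed d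
  ... | fixed eq = inj₁ (clampFixed-outside d (λ _ → []≔-other lo a) (λ _ _ → refl) z-fixed (fixed eq))
  ... | above lt eq = inj₁ (clampFixed-outside d (λ _ → []≔-other lo a) (λ _ _ → refl) z-fixed (above lt eq))
  ... | below lt eq = inj₂ (zd , subst (f z ! d <_) zd lt)
    where zd = trans eq ([]≔-same lo d a)

  module Witnesses {d e : Fin 3} (T : Complement i d e) where
    open Complement T

    -- p certifies that the part of the box above c in coordinate d can be dropped.
    record LowerWitness (lo hi : Pt ns) (c : ℕ) (p : Pt ns) : Set where
      constructor lowerWitness
      field
        in-slice : p ! i ≡ toℕ v
        c≤p : c ≤ p ! d
        fp≤c : f p ! d ≤ c
        reach : hi ! e ≤ p ! e ⊎ (p ! d ≡ c × toℕ v ≤ f p ! i × lo ! e ≤ p ! e)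

    -- p certifies that the part of the box below c in coordinate d can be dropped.
    record UpperWitness (lo hi : Pt ns) (c : ℕ) (p : Pt ns) : Set where
      constructor upperWitness
      field
        in-slice : p ! i ≡ toℕ v
        p≤c : p ! d ≤ c
        c≤fp : c ≤ f p ! d
        reach : p ! e ≤ lo ! e ⊎ (p ! d ≡ c × f p ! i ≤ toℕ v × p ! e ≤ hi ! e)

    lowerWitness-violates : ∀ {lo hi c p z} → LowerWitness lo hi c p →
      z ! i ≡ toℕ v → z ! d ≡ c → c < f z ! d → z ! e ≤ hi ! e →
      f z ! i < toℕ v ⊎ z ! e ≡ lo ! e → ViolatesWith z p
    lowerWitness-violates {p = p} {z} (lowerWitness p-i c≤p fp≤c reach) zi zd c<fz z≤hi obstruction
      with z ! e ≤? p ! e | reach | obstruction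
    ... | yes ze≤pe | _ | _ = inj₁ (violation-at z≼p d (≤-<-trans fp≤c c<fz))
      where z≼p = ≼-by-coords T (≤-reflexive (trans zi (sym p-i))) (≤-by-≡ zd refl c≤p) ze≤pe
    ... | no ze≰pe | inj₁ hi≤pe | _ = ⊥-elim (ze≰pe (≤-trans z≤hi hi≤pe))
    ... | no ze≰pe | inj₂ (pd≡c , v≤fp , _) | inj₁ fz<v = inj₂ (violation-at p≼z i (<-≤-trans fz<v v≤fp))
      where
      p≼z = ≼-by-coords T (≤-reflexive (trans p-i (sym zi))) (≤-reflexive (trans pd≡c (sym zd)))
              (<⇒≤ (≰⇒> ze≰pe))
    ... | no ze≰pe | inj₂ (_ , _ , lo≤pe) | inj₂ ze≡lo = ⊥-elim (ze≰pe (≤-by-≡ ze≡lo refl lo≤pe))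

    upperWitness-violates : ∀ {lo hi c p z} → UpperWitness lo hi c p →
      z ! i ≡ toℕ v → z ! d ≡ c → f z ! d < c → lo ! e ≤ z ! e →
      toℕ v < f z ! i ⊎ z ! e ≡ hi ! e → ViolatesWith z p
    upperWitness-violates {p = p} {z} (upperWitness p-i p≤c c≤fp reach) zi zd fz<c lo≤z obstruction
      with p ! e ≤? z ! e | reach | obstruction
    ... | yes pe≤ze | _ | _ = inj₂ (violation-at p≼z d (<-≤-trans fz<c c≤fp))
      where p≼z = ≼-by-coords T (≤-reflexive (trans p-i (sym zi))) (≤-by-≡ refl zd p≤c) pe≤ze
    ... | no pe≰ze | inj₁ pe≤lo | _ = ⊥-elim (pe≰ze (≤-trans pe≤lo lo≤z))
    ... | no pe≰ze | inj₂ (pd≡c , fp≤v , _) | inj₁ v<fz = inj₁ (violation-at z≼p i (≤-<-trans fp≤v v<fz))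
      where
      z≼p = ≼-by-coords T (≤-reflexive (trans zi (sym p-i))) (≤-reflexive (trans zd (sym pd≡c)))
              (<⇒≤ (≰⇒> pe≰ze))
    ... | no pe≰ze | inj₂ (_ , _ , pe≤hi) | inj₂ ze≡hi = ⊥-elim (pe≰ze (≤-by-≡ refl ze≡hi pe≤hi))

    lowerWitness-certifies : ∀ {lo hi h A c p z} → p ∈ A → LowerWitness lo hi c p →
      z ! i ≡ toℕ v → z ! d ≡ c → c < f z ! d → z ! e ≤ hi ! e →
      Clamped (lo ! e) h (z ! e) (f z ! e) → Solution z ⊎ Any (ViolatesWith z) A
    lowerWitness-certifies {z = z} p∈ w zi zd c<fz z≤hi z-fixed-e
      with toℕ v ≤? f z ! i | clamped⇒≤⊎≡l z-fixed-e
    ... | yes v≤fz | inj₁ ze≤fz =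
      inj₁ (inj₁ (≼-by-coords T (≤-by-≡ zi refl v≤fz) (<⇒≤ (≤-by-≡ (cong suc zd) refl c<fz)) ze≤fz))
    ... | yes _ | inj₂ ze≡lo = inj₂ (lose p∈ (lowerWitness-violates w zi zd c<fz z≤hi (inj₂ ze≡lo)))
    ... | no v≰fz | _ = inj₂ (lose p∈ (lowerWitness-violates w zi zd c<fz z≤hi (inj₁ (≰⇒> v≰fz))))

    upperWitness-certifies : ∀ {lo hi l A c p z} → p ∈ A → UpperWitness lo hi c p →
      z ! i ≡ toℕ v → z ! d ≡ c → f z ! d < c → lo ! e ≤ z ! e →
      Clamped l (hi ! e) (z ! e) (f z ! e) → Solution z ⊎ Any (ViolatesWith z) A
    upperWitness-certifies {z = z} p∈ w zi zd fz<c lo≤z z-fixed-e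
      with f z ! i ≤? toℕ v | clamped⇒≥⊎≡h z-fixed-e
    ... | yes fz≤v | inj₁ fze≤ze =
      inj₁ (inj₂ (≼-by-coords T (≤-by-≡ refl zi fz≤v) (<⇒≤ (≤-by-≡ refl zd fz<c)) fze≤ze))
    ... | yes _ | inj₂ ze≡hi = inj₂ (lose p∈ (upperWitness-violates w zi zd fz<c lo≤z (inj₂ ze≡hi)))
    ... | no fz≰v | _ = inj₂ (lose p∈ (upperWitness-violates w zi zd fz<c lo≤z (inj₁ (≰⇒> fz≰v))))

    certified-[]≔hi : ∀ {lo hi A p} (a : Fin (ns d)) → lo ! i ≡ toℕ v → hi ! i ≡ toℕ v →
      toℕ a ≤ hi ! d → Certified lo hi A → p ∈ A → LowerWitness lo hi (toℕ a) p →
      Certified lo (hi [ d ]≔ a) A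
    certified-[]≔hi {lo} {hi} a lo-i hi-i a≤hi cert p∈ w z lo≼z z≼hi′ z-fixed =
      [ cert z lo≼z z≼hi
      , uncurry (λ zd a<fz → lowerWitness-certifies p∈ w (slice-squeeze lo-i hi-i lo≼z z≼hi) zd a<fz
                               (z≼hi e) (z-fixed e))
      ]′ (clampFixed-[]≔hi d a z-fixed)
      where
      z≼hi : z ≼ hi
      z≼hi = ≼-trans z≼hi′ ([]≔-≼ ≼-refl a≤hi)

    certified-[]≔lo : ∀ {lo hi A p} (a : Fin (ns d)) → lo ! i ≡ toℕ v → hi ! i ≡ toℕ v →
      lo ! d ≤ toℕ a → Certified lo hi A → p ∈ A → UpperWitness lo hi (toℕ a) p →
      Certified (lo [ d ]≔ a) hi A
    certified-[]≔lo {lo} {hi} a lo-i hi-i lo≤a cert p∈ w z lo≼z′ z≼hi z-fixed =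
      [ cert z lo≼z z≼hi
      , uncurry (λ zd fz<a → upperWitness-certifies p∈ w (slice-squeeze lo-i hi-i lo≼z z≼hi) zd fz<a
                               (lo≼z e) (z-fixed e))
      ]′ (clampFixed-[]≔lo d a z-fixed)
      where
      lo≼z : lo ≼ z
      lo≼z = ≼-trans (≼-[]≔ ≼-refl lo≤a) lo≼z′

module Correctness (ns : Dims) (f : Pt ns → Pt ns) (a b : Pt ns) (i : Fin 3) (v : Fin (ns i)) where
  open Points ns
  open Algorithm ns i v
  open Certificates ns f i v

  Correct : Output ns → Set
  Correct = CorrectInner f a b i v

  record Valid (lo hi : Pt ns) (A : List (Pt ns)) : Set where
    field
      lo≼hi : lo ≼ hi
      lo-slice : lo ! i ≡ toℕ v
      hi-slice : hi ! i ≡ toℕ v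
      a≼lo : a ≼ lo
      hi≼b : hi ≼ b
      A-inside : All (InSub a b) A
      certified : Certified lo hi A

  data StepOK (lo hi : Pt ns) (A : List (Pt ns)) : Step ns → Set where
    finished : ∀ {o} → Correct o → StepOK lo hi A (done o)
    shrunk : ∀ {lo′ hi′} → Valid lo′ hi′ A → potential lo′ hi′ < potential lo hi →
      StepOK lo hi A (next lo′ hi′)

  T₀ : Complement i j k
  T₀ = complement i

  T₁ : Complement i k j
  T₁ = complement-swap T₀

  ∈-slice : ∀ {x} → x ! i ≡ toℕ v → InSlice i v x
  ∈-slice = FP.toℕ-injective

  solution-if-pinned : ∀ {z} → z ! i ≡ toℕ v → f z ! j ≡ z ! j → f z ! k ≡ z ! k → Solution z
  solution-if-pinned {z} zi fzj fzk with toℕ v ≤? f z ! i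
  ... | yes v≤fz = inj₁ (≼-by-coords T₀ (≤-by-≡ zi refl v≤fz) (≤-reflexive (sym fzj)) (≤-reflexive (sym fzk)))
  ... | no v≰fz = inj₂ (≼-by-coords T₀ (≤-by-≡ refl zi (<⇒≤ (≰⇒> v≰fz))) (≤-reflexive fzj) (≤-reflexive fzk))

  findViolation-correct : ∀ {z} A → InSub a b z → All (InSub a b) A → Any (ViolatesWith z) A →
    Correct (run (findViolation z (f z) A) f) × queries (findViolation z (f z) A) f ≤ length A
  findViolation-correct {z} (p ∷ A) z-in (p-in ∷ A-in) violates =
    choose-elim Q (violation? p (f p) z (f z)) (λ pz → (p-in , z-in , pz) , s≤s z≤n) λ ¬pz →
    choose-elim Q (violation? z (f z) p (f p)) (λ zp → (z-in , p-in , zp) , s≤s z≤n) λ ¬zp →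
    Product.map₂ s≤s (findViolation-correct A z-in A-in (drop ¬pz ¬zp violates))
    where
    Q : QTree ns → Set
    Q t = Correct (run t f) × suc (queries t f) ≤ suc (length A)
    drop : ¬ Violation f p z → ¬ Violation f z p → Any (ViolatesWith z) (p ∷ A) → Any (ViolatesWith z) A
    drop _ ¬zp (here (inj₁ zp)) = ⊥-elim (¬zp zp)
    drop ¬pz _ (here (inj₂ pz)) = ⊥-elim (¬pz pz)
    drop _ _ (there violates′) = violates′

  finish-correct : ∀ {z} A → InSub a b z → z ! i ≡ toℕ v → All (InSub a b) A →
    Solution z ⊎ Any (ViolatesWith z) A →
    Correct (run (finish z A) f) × queries (finish z A) f ≤ suc (length A)
  finish-correct {z} A z-in zi A-in certificate =
    choose-elim Q (z ≼? f z ⊎-dec f z ≼? z) (λ sol → (z-in , ∈-slice {z} zi , sol) , s≤s z≤n) λ ¬sol →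
    Product.map₂ s≤s (findViolation-correct A z-in A-in
      ([ (λ sol → ⊥-elim (¬sol sol)) , (λ violates → violates) ]′ certificate))
    where
    Q : QTree ns → Set
    Q t = Correct (run t f) × suc (queries t f) ≤ suc (length A)

  module _ {lo hi A} (V : Valid lo hi A) where
    open Valid V

    inside : ∀ {x} → lo ≼ x → x ≼ hi → InSub a b x
    inside lo≼x x≼hi = ≼-trans a≼lo lo≼x , ≼-trans x≼hi hi≼b

    solution-ok : ∀ {x B} → lo ≼ x → x ≼ hi → x ! i ≡ toℕ v → Solution x → StepOK lo hi B (done (point x))
    solution-ok {x} lo≼x x≼hi xi sol = finished (inside lo≼x x≼hi , ∈-slice {x} xi , sol)

    valid-++ : ∀ B → All (InSub a b) B → Valid lo hi (B ++ A)
    valid-++ B B-inside = record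
      { lo≼hi = lo≼hi ; lo-slice = lo-slice ; hi-slice = hi-slice ; a≼lo = a≼lo ; hi≼b = hi≼b
      ; A-inside = All.++⁺ B-inside A-inside ; certified = certified-++ B certified }

    finish-collapsed : span lo hi j ≡ 0 → span lo hi k ≡ 0 →
      Correct (run (finish lo A) f) × queries (finish lo A) f ≤ suc (length A)
    finish-collapsed sj sk =
      finish-correct A (inside (≼-refl {lo}) lo≼hi) lo-slice A-inside (certified lo ≼-refl lo≼hi lo-fixed)
      where
      lo-fixed : ClampFixed lo hi lo
      lo-fixed c with Complement.cover T₀ c
      ... | inj₁ refl = clamped-point refl (trans hi-slice (sym lo-slice))
      ... | inj₂ (inj₁ refl) = clamped-point refl (≤-antisym (m∸n≡0⇒m≤n sj) (lo≼hi j))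
      ... | inj₂ (inj₂ refl) = clamped-point refl (≤-antisym (m∸n≡0⇒m≤n sk) (lo≼hi k))

    module Shrinking {d e : Fin 3} (T : Complement i d e) where
      open Complement T
      open Witnesses T

      step-[]≔hi : ∀ {p} (x : Fin (ns d)) → lo ! d ≤ toℕ x → toℕ x ≤ hi ! d → p ∈ A →
        LowerWitness lo hi (toℕ x) p → rank (span lo (hi [ d ]≔ x) d) < rank (span lo hi d) →
        StepOK lo hi A (next lo (hi [ d ]≔ x))
      step-[]≔hi x lo≤x x≤hi p∈ w shrinks = shrunk
        record
          { lo≼hi = ≼-[]≔ lo≼hi lo≤x ; lo-slice = lo-slice ; hi-slice = trans ([]≔-other hi x d≢i) hi-slice
          ; a≼lo = a≼lo ; hi≼b = ≼-trans ([]≔-≼ ≼-refl x≤hi) hi≼b ; A-inside = A-inside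
          ; certified = certified-[]≔hi x lo-slice hi-slice x≤hi certified p∈ w }
        (potential-< {lo} {hi} {lo} {hi [ d ]≔ x} d (λ c → span-[]≔hi lo hi x) shrinks)

      step-[]≔lo : ∀ {p} (x : Fin (ns d)) → lo ! d ≤ toℕ x → toℕ x ≤ hi ! d → p ∈ A →
        UpperWitness lo hi (toℕ x) p → rank (span (lo [ d ]≔ x) hi d) < rank (span lo hi d) →
        StepOK lo hi A (next (lo [ d ]≔ x) hi)
      step-[]≔lo x lo≤x x≤hi p∈ w shrinks = shrunk
        record
          { lo≼hi = []≔-≼ lo≼hi x≤hi ; lo-slice = trans ([]≔-other lo x d≢i) lo-slice ; hi-slice = hi-slice
          ; a≼lo = ≼-trans a≼lo (≼-[]≔ ≼-refl lo≤x) ; hi≼b = hi≼b ; A-inside = A-inside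
          ; certified = certified-[]≔lo x lo-slice hi-slice lo≤x certified p∈ w }
        (potential-< {lo} {hi} {lo [ d ]≔ x} {hi} d (λ c → span-[]≔lo lo hi x) shrinks)

  module HalvingRound {d e : Fin 3} (T : Complement i d e) {lo hi : Pt ns} {A : List (Pt ns)}
                (V : Valid lo hi A) (wide : 2 ≤ span lo hi d) where
    open Complement T
    open Valid V
    open Halving d e lo hi
    open Witnesses T
    module E = Witnesses (complement-swap T)

    cutD-mid : toℕ cutD ≡ mid (lo ! d) (hi ! d)
    cutD-mid = toℕ-fromℕ-or (lo d) (<-trans (mid<h (lo≼hi d) wide) (FP.toℕ<n (hi d)))

    cutE-mid : toℕ cutE ≡ mid (lo ! e) (hi ! e)
    cutE-mid = toℕ-fromℕ-or (lo e) (≤-<-trans (mid≤h (lo≼hi e)) (FP.toℕ<n (hi e)))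

    lo<cut : lo ! d < toℕ cutD
    lo<cut = ≤-by-≡ refl cutD-mid (l<mid wide)

    cut<hi : toℕ cutD < hi ! d
    cut<hi = ≤-by-≡ (cong suc cutD-mid) refl (mid<h (lo≼hi d) wide)

    lo≤cutE : lo ! e ≤ toℕ cutE
    lo≤cutE = ≤-by-≡ refl cutE-mid (l≤mid (lo ! e) (hi ! e))

    cutE≤hi : toℕ cutE ≤ hi ! e
    cutE≤hi = ≤-by-≡ cutE-mid refl (mid≤h (lo≼hi e))

    loCut-i : loCut ! i ≡ toℕ v
    loCut-i = trans ([]≔-other lo cutD d≢i) lo-slice
    loCut-d : loCut ! d ≡ toℕ cutD
    loCut-d = []≔-same lo d cutD
    loCut-e : loCut ! e ≡ lo ! e
    loCut-e = []≔-other lo cutD d≢e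
    hiCut-i : hiCut ! i ≡ toℕ v
    hiCut-i = trans ([]≔-other hi cutD d≢i) hi-slice
    hiCut-d : hiCut ! d ≡ toℕ cutD
    hiCut-d = []≔-same hi d cutD
    hiCut-e : hiCut ! e ≡ hi ! e
    hiCut-e = []≔-other hi cutD d≢e
    centre-i : centre ! i ≡ toℕ v
    centre-i = trans ([]≔-other loCut cutE e≢i) loCut-i
    centre-d : centre ! d ≡ toℕ cutD
    centre-d = trans ([]≔-other loCut cutE (d≢e ∘ sym)) loCut-d
    centre-e : centre ! e ≡ toℕ cutE
    centre-e = []≔-same loCut e cutE

    lo≼loCut : lo ≼ loCut
    lo≼loCut = ≼-[]≔ ≼-refl (<⇒≤ lo<cut)
    loCut≼hi : loCut ≼ hi
    loCut≼hi = []≔-≼ lo≼hi (<⇒≤ cut<hi)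
    lo≼hiCut : lo ≼ hiCut
    lo≼hiCut = ≼-[]≔ lo≼hi (<⇒≤ lo<cut)
    hiCut≼hi : hiCut ≼ hi
    hiCut≼hi = []≔-≼ ≼-refl (<⇒≤ cut<hi)
    lo≼centre : lo ≼ centre
    lo≼centre = ≼-[]≔ lo≼loCut lo≤cutE
    centre≼hi : centre ≼ hi
    centre≼hi = []≔-≼ loCut≼hi cutE≤hi
    loCut≼hiCut : loCut ≼ hiCut
    loCut≼hiCut = ≼-by-coords T (≤-reflexive (trans loCut-i (sym hiCut-i)))
      (≤-reflexive (trans loCut-d (sym hiCut-d))) (≤-by-≡ loCut-e hiCut-e (lo≼hi e))

    A′ : List (Pt ns)
    A′ = loCut ∷ hiCut ∷ centre ∷ A

    loCut∈ : loCut ∈ A′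
    loCut∈ = here refl
    hiCut∈ : hiCut ∈ A′
    hiCut∈ = there (here refl)
    centre∈ : centre ∈ A′
    centre∈ = there (there (here refl))

    V′ : Valid lo hi A′
    V′ = valid-++ V (loCut ∷ hiCut ∷ centre ∷ [])
      (inside V lo≼loCut loCut≼hi ∷ inside V lo≼hiCut hiCut≼hi ∷ inside V lo≼centre centre≼hi ∷ [])

    open Shrinking V′ T
    module CE = Shrinking V′ (complement-swap T)

    Q : Step ns → Set
    Q = StepOK lo hi A′

    lower : ∀ {p} → p ∈ A′ → LowerWitness lo hi (toℕ cutD) p → Q (next lo hiCut)
    lower p∈ w = step-[]≔hi cutD (<⇒≤ lo<cut) (<⇒≤ cut<hi) p∈ w (rank-< wide halved)
      where
      halved : span lo hiCut d ≤ ⌈ span lo hi d /2⌉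
      halved = ≤-by-≡ (cong (_∸ lo ! d) (trans hiCut-d cutD-mid)) refl (mid∸l≤⌈/2⌉ (lo ! d) (hi ! d))

    raise : ∀ {p} → p ∈ A′ → UpperWitness lo hi (toℕ cutD) p → Q (next loCut hi)
    raise p∈ w = step-[]≔lo cutD (<⇒≤ lo<cut) (<⇒≤ cut<hi) p∈ w (rank-< wide halved)
      where
      halved : span loCut hi d ≤ ⌈ span lo hi d /2⌉
      halved = ≤-reflexive (trans (cong (hi ! d ∸_) (trans loCut-d cutD-mid)) (h∸mid≡⌈/2⌉ (lo ! d) (hi ! d)))

    lowerE : ∀ {p} → 2 ≤ span lo hi e → p ∈ A′ → E.LowerWitness lo hi (toℕ cutE) p → Q (next lo hiCutE)
    lowerE wideE p∈ w = CE.step-[]≔hi cutE lo≤cutE cutE≤hi p∈ w (rank-< wideE halved)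
      where
      halved : span lo hiCutE e ≤ ⌈ span lo hi e /2⌉
      halved = ≤-by-≡ (cong (_∸ lo ! e) (trans ([]≔-same hi e cutE) cutE-mid)) refl (mid∸l≤⌈/2⌉ (lo ! e) (hi ! e))

    raiseE : ∀ {p} → 2 ≤ span lo hi e → p ∈ A′ → E.UpperWitness lo hi (toℕ cutE) p → Q (next loCutE hi)
    raiseE wideE p∈ w = CE.step-[]≔lo cutE lo≤cutE cutE≤hi p∈ w (rank-< wideE halved)
      where
      halved : span loCutE hi e ≤ ⌈ span lo hi e /2⌉
      halved = ≤-reflexive (trans (cong (hi ! e ∸_) (trans ([]≔-same lo e cutE) cutE-mid)) (h∸mid≡⌈/2⌉ (lo ! e) (hi ! e)))

    thin-ok : f loCut ! d < toℕ cutD → toℕ cutD < f hiCut ! d → f loCut ! i < toℕ v → toℕ v < f hiCut ! i →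
      ¬ 2 ≤ span lo hi e → Q (thinDecision (f loCut) (f hiCut))
    thin-ok fLo<cut cut<fHi fLo<v v<fHi thin =
      choose-elim Q (f loCut ! e ≤? lo ! e)
        (λ fLo≤lo → solution-ok V lo≼loCut loCut≼hi loCut-i (inj₂ (≼-by-coords T
          (≤-by-≡ refl loCut-i (<⇒≤ fLo<v)) (≤-by-≡ refl loCut-d (<⇒≤ fLo<cut)) (≤-by-≡ refl loCut-e fLo≤lo)))) λ fLo≰lo →
      choose-elim Q (hi ! e ≤? f hiCut ! e)
        (λ hi≤fHi → solution-ok V lo≼hiCut hiCut≼hi hiCut-i (inj₁ (≼-by-coords T
          (≤-by-≡ hiCut-i refl (<⇒≤ v<fHi)) (≤-by-≡ hiCut-d refl (<⇒≤ cut<fHi)) (≤-by-≡ hiCut-e refl hi≤fHi)))) λ hi≰fHi →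
      finished (inside V lo≼loCut loCut≼hi , inside V lo≼hiCut hiCut≼hi ,
        violation-at loCut≼hiCut e (<-≤-trans (≰⇒> hi≰fHi) (≤-trans (2≰h∸l⇒h≤1+l thin) (≰⇒> fLo≰lo))))

    centreDown-ok : 2 ≤ span lo hi e → f centre ! d ≤ toℕ cutD → f centre ! i < toℕ v → Q (centreDown (f centre))
    centreDown-ok wideE fC≤cut fC<v =
      choose-elim Q (f centre ! e ≤? toℕ cutE)
        (λ fC≤cutE → solution-ok V lo≼centre centre≼hi centre-i (inj₂ (≼-by-coords T
          (≤-by-≡ refl centre-i (<⇒≤ fC<v)) (≤-by-≡ refl centre-d fC≤cut) (≤-by-≡ refl centre-e fC≤cutE)))) λ fC≰cutE →
      raiseE wideE centre∈ (E.upperWitness centre-i (≤-reflexive centre-e) (<⇒≤ (≰⇒> fC≰cutE))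
        (inj₂ (centre-e , <⇒≤ fC<v , ≤-by-≡ centre-d refl (<⇒≤ cut<hi))))

    centreUp-ok : 2 ≤ span lo hi e → toℕ cutD < f centre ! d → toℕ v < f centre ! i → Q (centreUp (f centre))
    centreUp-ok wideE cut<fC v<fC =
      choose-elim Q (toℕ cutE ≤? f centre ! e)
        (λ cutE≤fC → solution-ok V lo≼centre centre≼hi centre-i (inj₁ (≼-by-coords T
          (≤-by-≡ centre-i refl (<⇒≤ v<fC)) (≤-by-≡ centre-d refl (<⇒≤ cut<fC)) (≤-by-≡ centre-e refl cutE≤fC)))) λ cutE≰fC →
      lowerE wideE centre∈ (E.lowerWitness centre-i (≤-reflexive (sym centre-e)) (<⇒≤ (≰⇒> cutE≰fC))
        (inj₂ (centre-e , <⇒≤ v<fC , ≤-by-≡ refl centre-d (<⇒≤ lo<cut))))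

    centre-ok : 2 ≤ span lo hi e → Q (centreDecision (f centre))
    centre-ok wideE =
      choose-elim Q (f centre ! d ≤? toℕ cutD ×-dec toℕ v ≤? f centre ! i)
        (uncurry λ fC≤cut v≤fC → lower centre∈ (lowerWitness centre-i (≤-reflexive (sym centre-d)) fC≤cut
          (inj₂ (centre-d , v≤fC , ≤-by-≡ refl centre-e lo≤cutE)))) λ ¬lower →
      choose-elim Q (toℕ cutD ≤? f centre ! d ×-dec f centre ! i ≤? toℕ v)
        (uncurry λ cut≤fC fC≤v → raise centre∈ (upperWitness centre-i (≤-reflexive centre-d) cut≤fC
          (inj₂ (centre-d , fC≤v , ≤-by-≡ centre-e refl cutE≤hi)))) λ ¬raise →
      choose-elim Q (f centre ! d ≤? toℕ cutD)
        (λ fC≤cut → centreDown-ok wideE fC≤cut (≰⇒> (¬lower ∘ (fC≤cut ,_))))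
        (λ fC≰cut → centreUp-ok wideE (≰⇒> fC≰cut) (≰⇒> (¬raise ∘ (<⇒≤ (≰⇒> fC≰cut) ,_))))

    ok : Q (decision (f loCut) (f hiCut) (f centre))
    ok =
      choose-elim Q (toℕ cutD ≤? f loCut ! d)
        (λ cut≤fLo → raise loCut∈ (upperWitness loCut-i (≤-reflexive loCut-d) cut≤fLo
          (inj₁ (≤-reflexive loCut-e)))) λ cut≰fLo →
      choose-elim Q (f hiCut ! d ≤? toℕ cutD)
        (λ fHi≤cut → lower hiCut∈ (lowerWitness hiCut-i (≤-reflexive (sym hiCut-d)) fHi≤cut
          (inj₁ (≤-reflexive (sym hiCut-e))))) λ fHi≰cut →
      choose-elim Q (toℕ v ≤? f loCut ! i)
        (λ v≤fLo → lower loCut∈ (lowerWitness loCut-i (≤-reflexive (sym loCut-d)) (<⇒≤ (≰⇒> cut≰fLo))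
          (inj₂ (loCut-d , v≤fLo , ≤-reflexive (sym loCut-e))))) λ v≰fLo →
      choose-elim Q (f hiCut ! i ≤? toℕ v)
        (λ fHi≤v → raise hiCut∈ (upperWitness hiCut-i (≤-reflexive hiCut-d) (<⇒≤ (≰⇒> fHi≰cut))
          (inj₂ (hiCut-d , fHi≤v , ≤-reflexive hiCut-e)))) λ fHi≰v →
      choose-elim Q (2 ≤? span lo hi e) centre-ok
        (thin-ok (≰⇒> cut≰fLo) (≰⇒> fHi≰cut) (≰⇒> v≰fLo) (≰⇒> fHi≰v))

  module CornerRound {d e : Fin 3} (T : Complement i d e) {lo hi : Pt ns} {A : List (Pt ns)}
                (V : Valid lo hi A) (unit : 1 ≤ span lo hi d) (narrow-d : ¬ 2 ≤ span lo hi d)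
                (narrow-e : ¬ 2 ≤ span lo hi e) where
    open Complement T
    open Valid V
    open Corners d e lo hi
    open Witnesses T

    hi≡1+lo : hi ! d ≡ suc (lo ! d)
    hi≡1+lo = 1≤h∸l≱2⇒h≡1+l unit narrow-d

    span≡1 : span lo hi d ≡ 1
    span≡1 = trans (cong (_∸ lo ! d) hi≡1+lo) (m+n∸n≡m 1 (lo ! d))

    ≱hi⇒≤lo : ∀ {x} → ¬ hi ! d ≤ x → x ≤ lo ! d
    ≱hi⇒≤lo hi≰x = ≤-pred (≤-by-≡ refl (sym hi≡1+lo) (≰⇒> hi≰x))

    ≰lo⇒≥hi : ∀ {x} → ¬ x ≤ lo ! d → hi ! d ≤ x
    ≰lo⇒≥hi x≰lo = ≤-by-≡ hi≡1+lo refl (≰⇒> x≰lo)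

    hiLo-i : hiLo ! i ≡ toℕ v
    hiLo-i = trans ([]≔-other hi (lo d) d≢i) hi-slice
    hiLo-d : hiLo ! d ≡ lo ! d
    hiLo-d = []≔-same hi d (lo d)
    hiLo-e : hiLo ! e ≡ hi ! e
    hiLo-e = []≔-other hi (lo d) d≢e
    loHi-i : loHi ! i ≡ toℕ v
    loHi-i = trans ([]≔-other lo (hi d) d≢i) lo-slice
    loHi-d : loHi ! d ≡ hi ! d
    loHi-d = []≔-same lo d (hi d)
    loHi-e : loHi ! e ≡ lo ! e
    loHi-e = []≔-other lo (hi d) d≢e

    lo≼hiLo : lo ≼ hiLo
    lo≼hiLo = ≼-[]≔ {lo} {hi} {d} {lo d} lo≼hi ≤-refl
    hiLo≼hi : hiLo ≼ hi
    hiLo≼hi = []≔-≼ ≼-refl (lo≼hi d)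
    lo≼loHi : lo ≼ loHi
    lo≼loHi = ≼-[]≔ ≼-refl (lo≼hi d)
    loHi≼hi : loHi ≼ hi
    loHi≼hi = []≔-≼ {lo} {hi} {d} {hi d} lo≼hi ≤-refl

    A′ : List (Pt ns)
    A′ = lo ∷ hiLo ∷ loHi ∷ hi ∷ A

    lo∈ : lo ∈ A′
    lo∈ = here refl
    hiLo∈ : hiLo ∈ A′
    hiLo∈ = there (here refl)
    loHi∈ : loHi ∈ A′
    loHi∈ = there (there (here refl))
    hi∈ : hi ∈ A′
    hi∈ = there (there (there (here refl)))

    V′ : Valid lo hi A′
    V′ = valid-++ V (lo ∷ hiLo ∷ loHi ∷ hi ∷ [])
      (inside V ≼-refl lo≼hi ∷ inside V lo≼hiLo hiLo≼hi ∷ inside V lo≼loHi loHi≼hi ∷ inside V lo≼hi ≼-refl ∷ [])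

    open Shrinking V′ T

    Q : Step ns → Set
    Q = StepOK lo hi A′

    lower : ∀ {p} → p ∈ A′ → LowerWitness lo hi (lo ! d) p → Q (next lo hiLo)
    lower p∈ w = step-[]≔hi (lo d) ≤-refl (lo≼hi d) p∈ w
      (rank-1 (trans (cong (_∸ lo ! d) hiLo-d) (n∸n≡0 (lo ! d))) span≡1)

    raise : ∀ {p} → p ∈ A′ → UpperWitness lo hi (hi ! d) p → Q (next loHi hi)
    raise p∈ w = step-[]≔lo (hi d) (lo≼hi d) ≤-refl p∈ w
      (rank-1 (trans (cong (hi ! d ∸_) loHi-d) (n∸n≡0 (hi ! d))) span≡1)

    ok : Q (decision (f lo) (f hiLo) (f loHi) (f hi))
    ok =
      choose-elim Q (hi ! d ≤? f lo ! d)
        (λ hi≤fLo → raise lo∈ (upperWitness lo-slice (lo≼hi d) hi≤fLo (inj₁ ≤-refl))) λ hi≰fLo →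
      choose-elim Q (hi ! d ≤? f loHi ! d)
        (λ hi≤fLoHi → raise loHi∈ (upperWitness loHi-i (≤-reflexive loHi-d) hi≤fLoHi (inj₁ (≤-reflexive loHi-e)))) λ _ →
      choose-elim Q (f hiLo ! d ≤? lo ! d)
        (λ fHiLo≤lo → lower hiLo∈ (lowerWitness hiLo-i (≤-reflexive (sym hiLo-d)) fHiLo≤lo (inj₁ (≤-reflexive (sym hiLo-e))))) λ _ →
      choose-elim Q (f hi ! d ≤? lo ! d)
        (λ fHi≤lo → lower hi∈ (lowerWitness hi-slice (lo≼hi d) fHi≤lo (inj₁ ≤-refl))) λ fHi≰lo →
      choose-elim Q (toℕ v ≤? f lo ! i)
        (λ v≤fLo → lower lo∈ (lowerWitness lo-slice ≤-refl (≱hi⇒≤lo hi≰fLo) (inj₂ (refl , v≤fLo , ≤-refl)))) λ v≰fLo →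
      choose-elim Q (f hi ! i ≤? toℕ v)
        (λ fHi≤v → raise hi∈ (upperWitness hi-slice ≤-refl (≰lo⇒≥hi fHi≰lo) (inj₂ (refl , fHi≤v , ≤-refl)))) λ fHi≰v →
      choose-elim Q (f lo ! e ≤? lo ! e)
        (λ fLo≤lo → solution-ok V ≼-refl lo≼hi lo-slice (inj₂ (≼-by-coords T
          (≤-by-≡ refl lo-slice (<⇒≤ (≰⇒> v≰fLo))) (≱hi⇒≤lo hi≰fLo) fLo≤lo))) λ fLo≰lo →
      choose-elim Q (hi ! e ≤? f hi ! e)
        (λ hi≤fHi → solution-ok V lo≼hi ≼-refl hi-slice (inj₁ (≼-by-coords T
          (≤-by-≡ hi-slice refl (<⇒≤ (≰⇒> fHi≰v))) (≰lo⇒≥hi fHi≰lo) hi≤fHi))) λ hi≰fHi →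
      finished (inside V ≼-refl lo≼hi , inside V lo≼hi ≼-refl ,
        violation-at lo≼hi e (<-≤-trans (≰⇒> hi≰fHi) (≤-trans (2≰h∸l⇒h≤1+l narrow-e) (≰⇒> fLo≰lo))))

  mutual
    search-correct : ∀ F {lo hi A} → Valid lo hi A → potential lo hi ≤ F →
      Correct (run (search F lo hi A) f) × queries (search F lo hi A) f ≤ 8 * F + 1 + length A
    search-correct zero {lo} {hi} V Φ≤0 =
      finish-collapsed V (potential≤0 {lo} {hi} Φ≤0 j) (potential≤0 {lo} {hi} Φ≤0 k)
    search-correct (suc F) {lo} {hi} {A} V Φ≤ =
      choose-elim Q (2 ≤? span lo hi j)
        (λ wide → Product.map₂ (step-cost 3 (n≤1+n 3))
          (proceed-correct F (HalvingRound.ok T₀ V wide) Φ≤)) λ narrow-j →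
      choose-elim Q (2 ≤? span lo hi k)
        (λ wide → Product.map₂ (step-cost 3 (n≤1+n 3))
          (proceed-correct F (HalvingRound.ok T₁ V wide) Φ≤)) λ narrow-k →
      choose-elim Q (1 ≤? span lo hi j)
        (λ unit → Product.map₂ (step-cost 4 ≤-refl)
          (proceed-correct F (CornerRound.ok T₀ V unit narrow-j narrow-k) Φ≤)) λ flat-j →
      choose-elim Q (1 ≤? span lo hi k)
        (λ unit → Product.map₂ (step-cost 4 ≤-refl)
          (proceed-correct F (CornerRound.ok T₁ V unit narrow-k narrow-j) Φ≤)) λ flat-k →
      Product.map₂ (λ q≤ → ≤-trans q≤ (finish-cost (suc F) (length A)))
        (finish-collapsed V (n<1⇒n≡0 (≰⇒> flat-j)) (n<1⇒n≡0 (≰⇒> flat-k)))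
      where
      Q : QTree ns → Set
      Q t = Correct (run t f) × queries t f ≤ 8 * suc F + 1 + length A

    proceed-correct : ∀ F {lo hi A r} → StepOK lo hi A r → potential lo hi ≤ suc F →
      Correct (run (proceed F r A) f) × queries (proceed F r A) f ≤ 8 * F + 1 + length A
    proceed-correct F (finished correct) _ = correct , z≤n
    proceed-correct F (shrunk V′ Φ′<Φ) Φ≤ = search-correct F V′ (≤-pred (<-≤-trans Φ′<Φ Φ≤))

  module Initial (a≼b : a ≼ b) (a-up : Up f a) (b-down : Down f b) (a≤v : a i F.≤ v) (v≤b : v F.≤ b i) where

    lo₀ hi₀ : Pt ns
    lo₀ = a [ i ]≔ v
    hi₀ = b [ i ]≔ v

    lo₀-i : lo₀ ! i ≡ toℕ v
    lo₀-i = []≔-same a i v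
    hi₀-i : hi₀ ! i ≡ toℕ v
    hi₀-i = []≔-same b i v

    a≼lo₀ : a ≼ lo₀
    a≼lo₀ = ≼-[]≔ ≼-refl a≤v
    hi₀≼b : hi₀ ≼ b
    hi₀≼b = []≔-≼ ≼-refl v≤b
    lo₀≼hi₀ : lo₀ ≼ hi₀
    lo₀≼hi₀ = ≼-[]≔ ([]≔-≼ a≼b v≤b) (≤-reflexive lo₀-i)

    pinned : ∀ {z} c → i ≢ c → lo₀ ≼ z → z ≼ hi₀ → Clamped (lo₀ ! c) (hi₀ ! c) (z ! c) (f z ! c) →
      f z ! c ≡ z ! c ⊎ Any (ViolatesWith z) (a ∷ b ∷ [])
    pinned c i≢c lo≼z z≼hi (fixed fz≡z) = inj₁ fz≡z
    pinned c i≢c lo≼z z≼hi (below fz<z z≡lo) = inj₂ (here (inj₂ (violation-at (≼-trans a≼lo₀ lo≼z) c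
      (<-≤-trans fz<z (≤-by-≡ (trans z≡lo ([]≔-other a v i≢c)) refl (a-up c))))))
    pinned c i≢c lo≼z z≼hi (above z<fz z≡hi) = inj₂ (there (here (inj₁ (violation-at (≼-trans z≼hi hi₀≼b) c
      (≤-<-trans (≤-by-≡ refl (trans z≡hi ([]≔-other b v i≢c)) (b-down c)) z<fz)))))

    certified₀ : Certified lo₀ hi₀ (a ∷ b ∷ [])
    certified₀ z lo≼z z≼hi z-fixed
      with pinned j (Complement.d≢i T₀ ∘ sym) lo≼z z≼hi (z-fixed j)
         | pinned k (Complement.e≢i T₀ ∘ sym) lo≼z z≼hi (z-fixed k)
    ... | inj₁ fzj | inj₁ fzk = inj₁ (solution-if-pinned (slice-squeeze lo₀-i hi₀-i lo≼z z≼hi) fzj fzk)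
    ... | inj₂ violates | _ = inj₂ violates
    ... | inj₁ _ | inj₂ violates = inj₂ violates

    valid₀ : Valid lo₀ hi₀ (a ∷ b ∷ [])
    valid₀ = record
      { lo≼hi = lo₀≼hi₀ ; lo-slice = lo₀-i ; hi-slice = hi₀-i ; a≼lo = a≼lo₀ ; hi≼b = hi₀≼b
      ; A-inside = (≼-refl , a≼b) ∷ (a≼b , ≼-refl) ∷ [] ; certified = certified₀ }

    potential₀ : potential lo₀ hi₀ ≤ fuel ns
    potential₀ = potential-≤ {lo₀} {hi₀} λ c → rank-≤ (≤-trans (m∸n≤m (hi₀ ! c) (lo₀ ! c))
      (≤-trans (<⇒≤ (<-≤-trans (FP.toℕ<n (hi₀ c)) (ns≤width ns c))) (<⇒≤ (n<2^[1+⌊log₂n⌋] (width ns)))))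

    correct : Correct (run (inner ns a b i v) f) × queries (inner ns a b i v) f ≤ 8 * fuel ns + 1 + 2
    correct = search-correct (fuel ns) valid₀ potential₀

theorem14 : ∃[ C ] Σ InnerAlg λ A →
    (ns : Dims) (f : Pt ns → Pt ns) (a b : Pt ns) (i : Fin 3) (v : Fin (ns i)) →
    a ≼ b → Up f a → Down f b → a i F.≤ v → v F.≤ b i →
    CorrectInner f a b i v (run (A ns a b i v) f)
      × queries (A ns a b i v) f ≤ C * suc ⌊log₂ width ns ⌋
theorem14 = 51 , inner , λ ns f a b i v a≼b a-up b-down a≤v v≤b →
  Product.map₂ (λ q≤ → ≤-trans q≤ (query-bound ⌊log₂ width ns ⌋))
    (Correctness.Initial.correct ns f a b i v a≼b a-up b-down a≤v v≤b)
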